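{- Let $I=C_k$ or $I=\mathbb Z$. For $i\in I$ let $\mathfrak M_i=\langle M_i,\mathcal L_i,\mathrm I_i\rangle$ be a connected partial linear space, let $\phi_i=(\phi'_i,\phi''_i)$ be a correlation of $\mathfrak M_i$ onto $\mathfrak M_{i+1}$, and let $\xi_i=(\xi'_i,\xi''_i)$ be a correlation of $\mathfrak M_i$ onto $\mathfrak M_{ -i}$. Let $\mathfrak M=\circledast_{i\in I}(\mathfrak M_i,\phi_i)=\langle X,H,\mathrm I\rangle$. Assume that $\phi''_{ -i}\circ\xi'_i\circ\phi''_{i-1}=\xi''_{i-1}$ for all $i\in I$. Then $\mathfrak M$ is self dual, and the pair $\varkappa=(\varkappa',\varkappa'')$, $\varkappa'\colon X\to H$, $\varkappa''\colon H\to X$, given by $\varkappa'((i,x))=[-i,\xi'_i(x)]$ and $\varkappa''([i,y])=(-i,\xi''_i(y))$, is a correlation of $\mathfrak M$.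
   Context: A partial linear space (PLS) is an incidence structure $\langle S,\mathcal L,\mathrm{I}\rangle$ with $S\cap\mathcal L=\emptyset$, every line incident with at least two points, every point incident with at least two lines, and two distinct points incident with at most one common line; connected means the collinearity graph is connected. A correlation of $\langle S_1,\mathcal L_1,\mathrm I_1\rangle$ onto $\langle S_2,\mathcal L_2,\mathrm I_2\rangle$ is a pair $(\phi',\phi'')$ of bijections $\phi'\colon S_1\to\mathcal L_2$, $\phi''\colon\mathcal L_1\to S_2$ with $a\,\mathrm I_1\,l\iff \phi''(l)\,\mathrm I_2\,\phi'(a)$; a correlation of a structure is a correlation onto itself, and a structure is self dual if it admits one. The structure $\circledast_{i\in I}(\mathfrak M_i,\phi_i)$ has point set $X=\bigcup_{i\in I}\{i\}\times M_i$, line set $H=\bigcup_{i\in I}\{i\}\times\mathcal L_i$ (lines written $[i,m]$), and $(i,a)\,\mathrm I\,[j,m]$ iff either $i=j$ and $a\,\mathrm I_i\,m$, or $i=j+1$ and $a=\phi''_j(m)$. -}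

module Defs where

open import Level using (Level; _⊔_; suc)
open import Data.Nat using (ℕ; NonZero) renaming (suc to ℕsuc)
open import Data.Nat.DivMod using (_mod_)
open import Data.Nat using (_∸_)
open import Data.Fin using (Fin; toℕ)
open import Data.Integer using (ℤ; -_) renaming (suc to ℤsuc)
open import Data.Product using (Σ; ∃; _×_; _,_)
open import Data.Sum using (_⊎_)
open import Relation.Nullary using (¬_)
open import Relation.Binary.PropositionalEquality using (_≡_)
open import Relation.Binary.Construct.Closure.ReflexiveTransitive using (Star)
open import Function.Definitions using (Bijective)
open import Function.Bundles using (_⇔_)

-- Incidence structures ⟨S, 𝓛, I⟩ : points and lines are separate types
-- (so S ∩ 𝓛 = ∅ holds by construction).

record IncStr : Set₁ where
  field
    Pt  : Set
    Ln  : Set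
    Inc : Pt → Ln → Set
open IncStr public

record IsPLS (𝔐 : IncStr) : Set where
  field
    line-two-points : ∀ (l : Ln 𝔐) → ∃ λ a → ∃ λ b → ¬ (a ≡ b) × Inc 𝔐 a l × Inc 𝔐 b l
    point-two-lines : ∀ (a : Pt 𝔐) → ∃ λ l → ∃ λ m → ¬ (l ≡ m) × Inc 𝔐 a l × Inc 𝔐 a m
    at-most-one-line : ∀ (a b : Pt 𝔐) (l m : Ln 𝔐) → ¬ (a ≡ b) →
                       Inc 𝔐 a l → Inc 𝔐 b l → Inc 𝔐 a m → Inc 𝔐 b m → l ≡ m

Collinear : (𝔐 : IncStr) → Pt 𝔐 → Pt 𝔐 → Set
Collinear 𝔐 a b = ∃ λ l → Inc 𝔐 a l × Inc 𝔐 b l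

IsConnected : IncStr → Set
IsConnected 𝔐 = ∀ (a b : Pt 𝔐) → Star (Collinear 𝔐) a b

record IsCorrelation (𝔐₁ 𝔐₂ : IncStr) (φ' : Pt 𝔐₁ → Ln 𝔐₂) (φ'' : Ln 𝔐₁ → Pt 𝔐₂) : Set where
  field
    bij'  : Bijective _≡_ _≡_ φ'
    bij'' : Bijective _≡_ _≡_ φ''
    preserves : ∀ (a : Pt 𝔐₁) (l : Ln 𝔐₁) → Inc 𝔐₁ a l ⇔ Inc 𝔐₂ (φ'' l) (φ' a)

record Correlation (𝔐₁ 𝔐₂ : IncStr) : Set where
  field
    φ'  : Pt 𝔐₁ → Ln 𝔐₂
    φ'' : Ln 𝔐₁ → Pt 𝔐₂
    isCorrelation : IsCorrelation 𝔐₁ 𝔐₂ φ' φ''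

SelfDual : IncStr → Set
SelfDual 𝔐 = Correlation 𝔐 𝔐

-- Index sets: I = C_k (k ≥ 1, realised as Fin k with arithmetic mod k) or I = ℤ

data IndexSet : Set where
  cyclic   : (k : ℕ) → .{{_ : NonZero k}} → IndexSet
  integers : IndexSet

Idx : IndexSet → Set
Idx (cyclic k) = Fin k
Idx integers   = ℤ

sucI : (I : IndexSet) → Idx I → Idx I
sucI (cyclic k) i = ℕsuc (toℕ i) mod k
sucI integers   i = ℤsuc i

negI : (I : IndexSet) → Idx I → Idx I
negI (cyclic k) i = (k ∸ toℕ i) mod k
negI integers   i = - i

module _ (I : IndexSet)
         (M L : Idx I → Set)
         (Inc' : (i : Idx I) → M i → L i → Set)
         (φ'' : (i : Idx I) → L i → M (sucI I i)) where

  data StarInc : Σ (Idx I) M → Σ (Idx I) L → Set where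
    same : ∀ {i a m} → Inc' i a m → StarInc (i , a) (i , m)
    next : ∀ {j m}   → StarInc (sucI I j , φ'' j m) (j , m)

  ⊛ : IncStr
  ⊛ = record { Pt = Σ (Idx I) M ; Ln = Σ (Idx I) L ; Inc = StarInc }

Str : (I : IndexSet) (M L : Idx I → Set) (Inc' : (i : Idx I) → M i → L i → Set) → Idx I → IncStr
Str I M L Inc' i = record { Pt = M i ; Ln = L i ; Inc = Inc' i }

-- Write ĉ[j, m] := (j+1, φ''_j(m)) for the point of layer j+1 on the line [j, m]. The compatibility
-- hypothesis says exactly ĉ ∘ κ' ∘ ĉ = κ'', so κ sends the incidence ĉ l I l between layers to
-- κ'' l = ĉ (κ' (ĉ l)) I κ' (ĉ l), again of that kind, and injectivity of ĉ and κ' gives the converse;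
-- incidences inside a layer are carried by the correlations ξ_i.
module Submission where

open import Defs
open import Axiom.UniquenessOfIdentityProofs.WithK using (uip)
open import Data.Fin using (toℕ)
open import Data.Fin.Properties using (toℕ-injective; toℕ-fromℕ<; toℕ<n)
open import Data.Integer using (pred) renaming (suc to sucℤ)
open import Data.Integer.Properties using (neg-involutive; pred-suc)
open import Data.Nat using (zero; suc; NonZero; _+_; _∸_; _<_; z<s)
open import Data.Nat.DivMod using (_%_; _mod_; m%n<n; n%n≡0; m<n⇒m%n≡m; [m+n]%n≡m%n; %-distribˡ-+)
open import Data.Nat.Properties using (+-suc; <⇒≤; ∸-monoʳ-<; m∸[m∸n]≡n)
open import Data.Product using (Σ; _×_; _,_; proj₁; proj₂; map)
open import Data.Product.Properties using (,-injectiveˡ; ,-injectiveʳ-UIP)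
open import Data.Product.Function.Dependent.Propositional using (Σ-↔)
open import Function.Bundles using (Inverse; _↔_; mk↔ₛ′; Bijection; mk⤖; mk⇔; Equivalence)
open import Function.Definitions using (Injective; Bijective)
open import Function.Properties.Bijection using (⤖⇒↔)
open import Function.Properties.Inverse using (↔⇒⤖)
open import Relation.Binary.PropositionalEquality using (_≡_; refl; sym; trans; cong; subst; module ≡-Reasoning)

open ≡-Reasoning

toℕ-mod : ∀ m n .{{_ : NonZero n}} → toℕ (m mod n) ≡ m % n
toℕ-mod m n = toℕ-fromℕ< (m%n<n m n)

[n∸[n∸m]%n]%n≡m : ∀ {m n} .{{_ : NonZero n}} → m < n → (n ∸ (n ∸ m) % n) % n ≡ m
[n∸[n∸m]%n]%n≡m {zero} {n} _ = begin
  (n ∸ n % n) % n  ≡⟨ cong (λ r → (n ∸ r) % n) (n%n≡0 n) ⟩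
  n % n            ≡⟨ n%n≡0 n ⟩
  0                ∎
[n∸[n∸m]%n]%n≡m {suc m} {n} m<n = begin
  (n ∸ (n ∸ suc m) % n) % n  ≡⟨ cong (λ r → (n ∸ r) % n) (m<n⇒m%n≡m (∸-monoʳ-< z<s (<⇒≤ m<n))) ⟩
  (n ∸ (n ∸ suc m)) % n      ≡⟨ cong (_% n) (m∸[m∸n]≡n (<⇒≤ m<n)) ⟩
  suc m % n                  ≡⟨ m<n⇒m%n≡m m<n ⟩
  suc m                      ∎

-- Adding n ∸ 1 undoes the successor modulo n.
suc-%-injective : ∀ {m o n} .{{_ : NonZero n}} → m < n → o < n → suc m % n ≡ suc o % n → m ≡ o
suc-%-injective {m} {o} {suc n} m<n o<n eq = begin
  m                                    ≡⟨ undo-suc m m<n ⟨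
  (suc m + n) % suc n                  ≡⟨ %-distribˡ-+ (suc m) n (suc n) ⟩
  (suc m % suc n + n % suc n) % suc n  ≡⟨ cong (λ r → (r + n % suc n) % suc n) eq ⟩
  (suc o % suc n + n % suc n) % suc n  ≡⟨ %-distribˡ-+ (suc o) n (suc n) ⟨
  (suc o + n) % suc n                  ≡⟨ undo-suc o o<n ⟩
  o                                    ∎
  where
  undo-suc : ∀ r → r < suc n → (suc r + n) % suc n ≡ r
  undo-suc r r<n = begin
    (suc r + n) % suc n  ≡⟨ cong (_% suc n) (+-suc r n) ⟨
    (r + suc n) % suc n  ≡⟨ [m+n]%n≡m%n r (suc n) ⟩
    r % suc n            ≡⟨ m<n⇒m%n≡m r<n ⟩
    r                    ∎

negI-involutive : (I : IndexSet) (i : Idx I) → negI I (negI I i) ≡ i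
negI-involutive (cyclic k) i = toℕ-injective (begin
  toℕ (negI (cyclic k) (negI (cyclic k) i))  ≡⟨ toℕ-mod _ k ⟩
  (k ∸ toℕ ((k ∸ toℕ i) mod k)) % k          ≡⟨ cong (λ r → (k ∸ r) % k) (toℕ-mod _ k) ⟩
  (k ∸ (k ∸ toℕ i) % k) % k                  ≡⟨ [n∸[n∸m]%n]%n≡m (toℕ<n i) ⟩
  toℕ i                                      ∎)
negI-involutive integers i = neg-involutive i

sucI-injective : (I : IndexSet) → Injective _≡_ _≡_ (sucI I)
sucI-injective (cyclic k) {i} {j} eq = toℕ-injective (suc-%-injective (toℕ<n i) (toℕ<n j) (begin
  suc (toℕ i) % k              ≡⟨ toℕ-mod _ k ⟨
  toℕ (sucI (cyclic k) i)      ≡⟨ cong toℕ eq ⟩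
  toℕ (sucI (cyclic k) j)      ≡⟨ toℕ-mod _ k ⟩
  suc (toℕ j) % k              ∎))
sucI-injective integers {i} {j} eq = begin
  i               ≡⟨ pred-suc i ⟨
  pred (sucℤ i)   ≡⟨ cong pred eq ⟩
  pred (sucℤ j)   ≡⟨ pred-suc j ⟩
  j               ∎

involution-injective : {A : Set} {f : A → A} → (∀ x → f (f x) ≡ x) → Injective _≡_ _≡_ f
involution-injective {f = f} f-involutive {x} {y} eq = begin
  x          ≡⟨ f-involutive x ⟨
  f (f x)    ≡⟨ cong f eq ⟩
  f (f y)    ≡⟨ f-involutive y ⟩
  y          ∎

module _ {A B : Set} {P : A → Set} {Q : B → Set} where

  Σ-map-injective : {f : A → B} {g : ∀ {x} → P x → Q (f x)} →
                    Injective _≡_ _≡_ f → (∀ {x} → Injective _≡_ _≡_ (g {x})) →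
                    Injective _≡_ _≡_ (map {P = P} {Q = Q} f g)
  Σ-map-injective f-inj g-inj {x , a} {y , b} eq with f-inj (,-injectiveˡ eq)
  ... | refl = cong (x ,_) (g-inj (,-injectiveʳ-UIP uip eq))

  Σ-map-bijective : (f : A ↔ B) {g : ∀ {x} → P x → Q (Inverse.to f x)} →
                    (∀ {x} → Bijective _≡_ _≡_ (g {x})) →
                    Bijective _≡_ _≡_ (map {P = P} {Q = Q} (Inverse.to f) g)
  Σ-map-bijective f g-bij = Bijection.bijective (↔⇒⤖ (Σ-↔ f (⤖⇒↔ (mk⤖ g-bij))))

module ⊛-Correlation
  (I : IndexSet) (M L : Idx I → Set) (Inc' : (i : Idx I) → M i → L i → Set)
  (φ'' : (i : Idx I) → L i → M (sucI I i))
  (φ''-injective : ∀ i → Injective _≡_ _≡_ (φ'' i))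
  (N : Idx I → Idx I) (N-involutive : ∀ i → N (N i) ≡ i)
  (ξ' : (i : Idx I) → M i → L (N i)) (ξ'' : (i : Idx I) → L i → M (N i))
  (ξ-corr : (i : Idx I) → IsCorrelation (Str I M L Inc' i) (Str I M L Inc' (N i)) (ξ' i) (ξ'' i))
  where

  𝔐 : IncStr
  𝔐 = ⊛ I M L Inc' φ''

  ĉ : Ln 𝔐 → Pt 𝔐
  ĉ = map (sucI I) (φ'' _)

  κ' : Pt 𝔐 → Ln 𝔐
  κ' = map N (ξ' _)

  κ'' : Ln 𝔐 → Pt 𝔐
  κ'' = map N (ξ'' _)

  Compatible : Set
  Compatible = ∀ j y → ĉ (κ' (ĉ (j , y))) ≡ κ'' (j , y)

  N-↔ : Idx I ↔ Idx I
  N-↔ = mk↔ₛ′ N N N-involutive N-involutive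

  N-injective : Injective _≡_ _≡_ N
  N-injective = involution-injective N-involutive

  module ξ i = IsCorrelation (ξ-corr i)

  κ'-bijective : Bijective _≡_ _≡_ κ'
  κ'-bijective = Σ-map-bijective {P = M} {Q = L} N-↔ (ξ.bij' _)

  κ''-bijective : Bijective _≡_ _≡_ κ''
  κ''-bijective = Σ-map-bijective {P = L} {Q = M} N-↔ (ξ.bij'' _)

  ĉ-injective : Injective _≡_ _≡_ ĉ
  ĉ-injective = Σ-map-injective {P = L} {Q = M} (sucI-injective I) (φ''-injective _)

  κ-preserves : Compatible → ∀ {p q} → Inc 𝔐 p q → Inc 𝔐 (κ'' q) (κ' p)
  κ-preserves compat (same {i} {a} {m} inc) = same (Equivalence.to (ξ.preserves i a m) inc)
  κ-preserves compat (next {j} {m}) = subst (λ x → Inc 𝔐 x (κ' (ĉ (j , m)))) (compat j m) next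

  κ-reflects : Compatible → ∀ {p q} → Inc 𝔐 (κ'' q) (κ' p) → Inc 𝔐 p q
  κ-reflects compat h = reflect h refl refl
    where
    reflect : ∀ {p q p' q'} → Inc 𝔐 p' q' → p' ≡ κ'' q → q' ≡ κ' p → Inc 𝔐 p q
    reflect {i , a} {j , m} (same inc) refl eq with N-injective {j} {i} (,-injectiveˡ eq)
    ... | refl with ,-injectiveʳ-UIP uip eq
    ... | refl = same (Equivalence.from (ξ.preserves j a m) inc)
    reflect {p} {j , m} next eq refl = subst (λ x → Inc 𝔐 x (j , m)) (sym p≡ĉq) next
      where
      p≡ĉq : p ≡ ĉ (j , m)
      p≡ĉq = proj₁ κ'-bijective (ĉ-injective (trans eq (sym (compat j m))))

  κ-isCorrelation : Compatible → IsCorrelation 𝔐 𝔐 κ' κ''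
  κ-isCorrelation compat = record
    { bij'      = κ'-bijective
    ; bij''     = κ''-bijective
    ; preserves = λ _ _ → mk⇔ (κ-preserves compat) (κ-reflects compat)
    }

proposition4p2 :
    (I : IndexSet)
    (M L : Idx I → Set)
    (Inc' : (i : Idx I) → M i → L i → Set)
    (pls : (i : Idx I) → IsPLS (Str I M L Inc' i))
    (conn : (i : Idx I) → IsConnected (Str I M L Inc' i))
    (φ' : (i : Idx I) → M i → L (sucI I i))
    (φ'' : (i : Idx I) → L i → M (sucI I i))
    (φ-corr : (i : Idx I) → IsCorrelation
                 (Str I M L Inc' i)
                 (Str I M L Inc' (sucI I i))
                 (φ' i) (φ'' i))
    (ξ' : (i : Idx I) → M i → L (negI I i))
    (ξ'' : (i : Idx I) → L i → M (negI I i))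
    (ξ-corr : (i : Idx I) → IsCorrelation
                 (Str I M L Inc' i)
                 (Str I M L Inc' (negI I i))
                 (ξ' i) (ξ'' i))
    (compat : (j : Idx I) (y : L j) →
                _≡_ {A = Σ (Idx I) M}
                  (sucI I (negI I (sucI I j)) , φ'' (negI I (sucI I j)) (ξ' (sucI I j) (φ'' j y)))
                  (negI I j , ξ'' j y)) →
    SelfDual (⊛ I M L Inc' φ'')
    × IsCorrelation (⊛ I M L Inc' φ'') (⊛ I M L Inc' φ'')
        (λ p → negI I (proj₁ p) , ξ' (proj₁ p) (proj₂ p))
        (λ q → negI I (proj₁ q) , ξ'' (proj₁ q) (proj₂ q))
proposition4p2 I M L Inc' _ _ _ φ'' φ-corr ξ' ξ'' ξ-corr compat =
  record { isCorrelation = κ-correlation } , κ-correlation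
  where
  open ⊛-Correlation I M L Inc' φ'' (λ i → proj₁ (IsCorrelation.bij'' (φ-corr i)))
                     (negI I) (negI-involutive I) ξ' ξ'' ξ-corr

  κ-correlation : IsCorrelation 𝔐 𝔐 κ' κ''
  κ-correlation = κ-isCorrelation compat
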